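{- Let $S=\{s_1<s_2<\cdots\}$ be an infinite subset of $\mathbb{N}$, enumerated increasingly. If $s_{n+1}-s_n\to\infty$, then $\mathbb{N}\setminus S$ is an IP*-set in $\mathbb{N}$.
   Context: $\mathbb{N}=\{1,2,\dots\}$. For a sequence $(x_i)_{i\ge1}$ in $\mathbb{N}$, $FS((x_i))=\{\sum_{i\in\alpha}x_i: \alpha\subset\mathbb{N} \text{ finite nonempty}\}$. $A\subset\mathbb{N}$ is an IP-set if $FS((x_i))\subset A$ for some sequence $(x_i)$ in $\mathbb{N}$; $B$ is an IP*-set if $B\cap A\neq\emptyset$ for every IP-set $A$. -}

module Defs where

open import Data.Nat using (ℕ; _+_; _∸_; _≤_; _<_; suc)
open import Data.List using (List; []; _∷_; map)
open import Data.Nat.ListAction using (sum)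
open import Data.List.Relation.Unary.Unique.Propositional using (Unique)
open import Data.List.Membership.Propositional using (_∈_)
open import Data.Product using (Σ; ∃; _×_)
open import Relation.Binary.PropositionalEquality using (_≡_; _≢_)
open import Relation.Nullary using (¬_)

-- Subsets of ℕ are predicates.  The paper's ℕ = {1,2,...}; we use
-- Agda's ℕ and impose positivity explicitly where relevant.
Pred : Set₁
Pred = ℕ → Set

record FinIdx : Set where
  constructor finIdx
  field
    elems    : List ℕ
    nonempty : elems ≢ []
    distinct : Unique elems

idxSum : (ℕ → ℕ) → FinIdx → ℕ
idxSum x α = sum (map x (FinIdx.elems α))

FS : (ℕ → ℕ) → Pred
FS x m = Σ FinIdx λ α → idxSum x α ≡ m

PosSeq : (ℕ → ℕ) → Set
PosSeq x = ∀ i → 1 ≤ x i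

IPSet : Pred → Set
IPSet A = Σ (ℕ → ℕ) λ x → PosSeq x × (∀ m → FS x m → A m)

IPStarSet : Pred → Set₁
IPStarSet B = (A : Pred) → IPSet A → ∃ λ m → B m × A m

-- s is a strictly increasing enumeration (indexed from 0) with values in {1,2,...}
StrictlyIncreasing : (ℕ → ℕ) → Set
StrictlyIncreasing s = ∀ n → s n < s (suc n)

RangeOf : (ℕ → ℕ) → Pred
RangeOf s m = ∃ λ n → s n ≡ m

ComplementInPos : Pred → Pred
ComplementInPos S m = 1 ≤ m × ¬ S m

GapsTendToInfinity : (ℕ → ℕ) → Set
GapsTendToInfinity s = ∀ M → ∃ λ N → ∀ n → N ≤ n → M ≤ s (suc n) ∸ s n

-- Take an IP-set FS(x) and let N be such that every gap of S from s_N on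
-- exceeds x₀.  The block sum t = x₁ + ⋯ + x_{s_N + 1} exceeds s_N, and t and
-- t + x₀ both lie in FS(x).  If t ∈ S, say t = s_k, then k ≥ N, so t + x₀
-- falls strictly inside the gap (s_k, s_{k+1}); hence t or t + x₀ avoids S.
module Submission where

open import Defs
open import Data.Nat using (ℕ; zero; suc; _+_; _∸_; _≤_; _<_; _≤′_; ≤′-refl; ≤′-step; z≤n; s≤s; _≟_)
open import Data.Nat.Properties
open import Data.Nat.ListAction using (sum)
open import Data.List using (List; []; _∷_; map; length; upTo)
open import Data.List.Properties using (length-map; length-upTo)
open import Data.List.Relation.Unary.All using (All; universal)
import Data.List.Relation.Unary.All.Properties as All
open import Data.List.Relation.Unary.AllPairs using (_∷_)
open import Data.List.Relation.Unary.Unique.Propositional using (Unique)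
import Data.List.Relation.Unary.Unique.Propositional.Properties as Unique
open import Data.Product using (∃; _×_; _,_)
open import Function using (_∘_)
open import Relation.Binary.PropositionalEquality
open import Relation.Nullary using (¬_; yes; no)
open import Relation.Nullary.Decidable using (map′)
open import Relation.Unary using (Decidable)

module _ {s : ℕ → ℕ} (s-inc : StrictlyIncreasing s) where

  s-mono-≤ : ∀ {m n} → m ≤ n → s m ≤ s n
  s-mono-≤ = mono′ ∘ ≤⇒≤′
    where
    mono′ : ∀ {m n} → m ≤′ n → s m ≤ s n
    mono′ ≤′-refl       = ≤-refl
    mono′ (≤′-step m≤n) = ≤-trans (mono′ m≤n) (<⇒≤ (s-inc _))

  s-mono-< : ∀ {m n} → m < n → s m < s n
  s-mono-< {n = suc n} (s≤s m≤n) = ≤-<-trans (s-mono-≤ m≤n) (s-inc n)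

  s-cancel-≤ : ∀ {m n} → s m ≤ s n → m ≤ n
  s-cancel-≤ sm≤sn = ≮⇒≥ (λ n<m → <⇒≱ (s-mono-< n<m) sm≤sn)

  s-cancel-< : ∀ {m n} → s m < s n → m < n
  s-cancel-< sm<sn = ≰⇒> (λ n≤m → <⇒≱ sm<sn (s-mono-≤ n≤m))

  n≤s[n] : ∀ n → n ≤ s n
  n≤s[n] zero    = z≤n
  n≤s[n] (suc n) = ≤-<-trans (n≤s[n] n) (s-inc n)

  range? : Decidable (RangeOf s)
  range? m = map′ (λ (n , _ , sn≡m) → n , sn≡m)
                  (λ (n , sn≡m) → n , s≤s (subst (n ≤_) sn≡m (n≤s[n] n)) , sn≡m)
                  (anyUpTo? (λ n → s n ≟ m) (suc m))

  ∉range-inside-gap : ∀ {k a} → 0 < a → a < s (suc k) ∸ s k → ¬ RangeOf s (s k + a)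
  ∉range-inside-gap {k} {a} 0<a a<gap (k′ , sk′≡sk+a) = <-irrefl refl (begin-strict
    s (suc k)               ≤⟨ s-mono-≤ (s-cancel-< sk<sk′) ⟩
    s k′                    ≡⟨ sk′≡sk+a ⟩
    s k + a                 <⟨ +-monoʳ-< (s k) a<gap ⟩
    s k + (s (suc k) ∸ s k) ≡⟨ m+[n∸m]≡n (<⇒≤ (s-inc k)) ⟩
    s (suc k)               ∎)
    where
    open ≤-Reasoning
    sk<sk′ : s k < s k′
    sk<sk′ = subst (s k <_) (sym sk′≡sk+a) (m<m+n (s k) 0<a)

length≤sum-map : ∀ {x} → PosSeq x → (l : List ℕ) → length l ≤ sum (map x l)
length≤sum-map x-pos []      = z≤n
length≤sum-map x-pos (i ∷ l) = +-mono-≤ (x-pos i) (length≤sum-map x-pos l)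

oneTo : ℕ → List ℕ
oneTo n = map suc (upTo n)

oneTo-unique : ∀ n → Unique (oneTo n)
oneTo-unique n = Unique.map⁺ suc-injective (Unique.upTo⁺ n)

FS-shift-pair : ∀ {x} → PosSeq x → ∀ n → ∃ λ t → n < t × FS x t × FS x (t + x 0)
FS-shift-pair {x} x-pos n =
  t , n<t , (finIdx block (λ ()) (oneTo-unique (suc n)) , refl)
          , (finIdx (0 ∷ block) (λ ()) (0∉block ∷ oneTo-unique (suc n)) , +-comm (x 0) t)
  where
  block : List ℕ
  block = oneTo (suc n)
  t : ℕ
  t = sum (map x block)
  0∉block : All (0 ≢_) block
  0∉block = All.map⁺ (universal {P = λ i → 0 ≢ suc i} (λ _ ()) (upTo (suc n)))
  n<t : n < t
  n<t = subst (_≤ t) (trans (length-map suc (upTo (suc n))) (length-upTo (suc n)))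
              (length≤sum-map x-pos block)

lemma3p3 : (s : ℕ → ℕ) → PosSeq s → StrictlyIncreasing s → GapsTendToInfinity s →
    IPStarSet (ComplementInPos (RangeOf s))
lemma3p3 s _ s-inc gaps A (x , x-pos , FS⊆A) with gaps (suc (x 0))
... | N , x0<gap with FS-shift-pair x-pos (s N)
... | t , sN<t , FS-t , FS-t+x0 with range? s-inc t
... | no t∉S = t , (0<t , t∉S) , FS⊆A t FS-t
  where
  0<t : 0 < t
  0<t = ≤-trans (s≤s z≤n) sN<t
... | yes (k , sk≡t) = t + x 0 , (0<t+x0 , t+x0∉S) , FS⊆A (t + x 0) FS-t+x0
  where
  0<t+x0 : 0 < t + x 0
  0<t+x0 = ≤-trans (s≤s z≤n) (≤-trans sN<t (m≤m+n t (x 0)))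
  N≤k : N ≤ k
  N≤k = s-cancel-≤ s-inc (<⇒≤ (subst (s N <_) (sym sk≡t) sN<t))
  t+x0∉S : ¬ RangeOf s (t + x 0)
  t+x0∉S = subst (¬_ ∘ RangeOf s) (cong (_+ x 0) sk≡t)
                 (∉range-inside-gap s-inc (x-pos 0) (x0<gap k N≤k))
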